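{- If an oriented hypergraph contains an incidence of multiplicity $k\ge3$ (i.e., a vertex $v$ and edge $e$ with $\iota(v,e)\ge3$), then it contains a cross-theta.
   Context: An oriented hypergraph has disjoint finite sets of vertices and edges, an incidence function $\iota:V\times E\to\mathbb Z_{\ge0}$ whose value $\iota(v,e)$ is the multiplicity of the incidence of $v$ and $e$, incidences $(v,e,k)$ with $1\le k\le\iota(v,e)$, and an orientation of the incidences. A path is a sequence $a_0,i_1,a_1,\dots,i_m,a_m$ alternating vertices and edges with $i_j$ an incidence containing $a_{j-1},a_j$, nothing repeated. A cross-theta is a set of three pairwise internally disjoint paths (sharing nothing but end-points) with the same two end-points, one a vertex and the other an edge. -}

module Defs where

open import Data.Nat using (ℕ; suc)
open import Data.Fin using (Fin; zero; suc; inject₁; fromℕ)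
open import Data.Bool using (Bool)
open import Data.Sum using (_⊎_; inj₁; inj₂)
open import Data.Product using (_×_; Σ; ∃; _,_)
open import Data.Empty using (⊥)
open import Relation.Binary.PropositionalEquality using (_≡_)
open import Function.Definitions using (Injective)

-- An oriented hypergraph with finite vertex set Fin nV and finite edge set
-- Fin nE (disjointness of V and E is built in via the sum type Elem below).
-- an incidence (v, e, k) with 1 ≤ k ≤ ι v e ; k is stored 0-based as Fin (ι v e)
record Incidence (nV nE : ℕ) (ι : Fin nV → Fin nE → ℕ) : Set where
  constructor inc
  field
    vert : Fin nV
    edge : Fin nE
    idx  : Fin (ι vert edge)

-- An oriented hypergraph with finite vertex set Fin nV and finite edge set
-- Fin nE (disjointness of V and E is built in via the sum type Elem below).
record OrientedHypergraph : Set₁ where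
  field
    nV nE : ℕ
    ι     : Fin nV → Fin nE → ℕ
    σ     : Incidence nV nE ι → Bool

module _ (H : OrientedHypergraph) where
  open OrientedHypergraph H

  Inc : Set
  Inc = Incidence nV nE ι

  Elem : Set
  Elem = Fin nV ⊎ Fin nE

  Links : Inc → Elem → Elem → Set
  Links i a b =
      (a ≡ inj₁ (Incidence.vert i) × b ≡ inj₂ (Incidence.edge i))
    ⊎ (a ≡ inj₂ (Incidence.edge i) × b ≡ inj₁ (Incidence.vert i))

  record Path : Set where
    field
      len    : ℕ
      elems  : Fin (suc len) → Elem
      incs   : Fin len → Inc
      links  : ∀ (j : Fin len) → Links (incs j) (elems (inject₁ j)) (elems (suc j))
      elems-inj : Injective _≡_ _≡_ elems
      incs-inj  : Injective _≡_ _≡_ incs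

    start end : Elem
    start = elems zero
    end   = elems (fromℕ len)

    _∈ₑ_ : Elem → Set
    _∈ₑ_ a = ∃ λ j → elems j ≡ a

    _∈ᵢ_ : Inc → Set
    _∈ᵢ_ i = ∃ λ j → incs j ≡ i

  InternallyDisjoint : Elem → Elem → Path → Path → Set
  InternallyDisjoint x y P Q =
      (∀ a → Path._∈ₑ_ P a → Path._∈ₑ_ Q a → a ≡ x ⊎ a ≡ y)
    × (∀ i → Path._∈ᵢ_ P i → Path._∈ᵢ_ Q i → ⊥)

  PathBetween : Elem → Elem → Path → Set
  PathBetween x y P = Path.start P ≡ x × Path.end P ≡ y

  record CrossTheta : Set where
    field
      v  : Fin nV
      e  : Fin nE
      P₁ P₂ P₃ : Path
      p₁ : PathBetween (inj₁ v) (inj₂ e) P₁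
      p₂ : PathBetween (inj₁ v) (inj₂ e) P₂
      p₃ : PathBetween (inj₁ v) (inj₂ e) P₃
      d₁₂ : InternallyDisjoint (inj₁ v) (inj₂ e) P₁ P₂
      d₁₃ : InternallyDisjoint (inj₁ v) (inj₂ e) P₁ P₃
      d₂₃ : InternallyDisjoint (inj₁ v) (inj₂ e) P₂ P₃

-- An incidence of multiplicity k gives k parallel one-step paths v, (v,e,j), e, which share
-- only their end-points; any three of them form a cross-theta.
module Submission where

open import Defs
open import Data.Nat using (_≤_; s≤s)
open import Data.Fin using (Fin; zero; suc)
open import Data.Sum using (_⊎_; inj₁; inj₂)
open import Data.Product using (Σ-syntax; _×_; _,_)
open import Relation.Nullary using (¬_)
open import Relation.Binary.PropositionalEquality using (_≡_; _≢_; refl; sym; trans)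
open OrientedHypergraph using (nV; nE; ι)

threeDistinct : ∀ {n} → 3 ≤ n →
  Σ[ a ∈ Fin n ] Σ[ b ∈ Fin n ] Σ[ c ∈ Fin n ] a ≢ b × a ≢ c × b ≢ c
threeDistinct (s≤s (s≤s (s≤s _))) =
  zero , suc zero , suc (suc zero) , (λ ()) , (λ ()) , (λ ())

module _ (H : OrientedHypergraph) (v : Fin (nV H)) (e : Fin (nE H)) where

  endpoint : Fin 2 → Elem H
  endpoint zero       = inj₁ v
  endpoint (suc zero) = inj₂ e

  endpoint-injective : ∀ {a b} → endpoint a ≡ endpoint b → a ≡ b
  endpoint-injective {zero}     {zero}     _ = refl
  endpoint-injective {zero}     {suc zero} ()
  endpoint-injective {suc zero} {zero}     ()
  endpoint-injective {suc zero} {suc zero} _ = refl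

  incidencePath : Fin (ι H v e) → Path H
  incidencePath k = record
    { len       = 1
    ; elems     = endpoint
    ; incs      = λ _ → inc v e k
    ; links     = λ { zero → inj₁ (refl , refl) }
    ; elems-inj = endpoint-injective
    ; incs-inj  = λ { {zero} {zero} _ → refl }
    }

  incidencePath-between : ∀ k → PathBetween H (inj₁ v) (inj₂ e) (incidencePath k)
  incidencePath-between k = refl , refl

  inc-idx-injective : ∀ {k l} → inc {ι = ι H} v e k ≡ inc v e l → k ≡ l
  inc-idx-injective refl = refl

  incidencePaths-internallyDisjoint : ∀ {k l} → k ≢ l →
    InternallyDisjoint H (inj₁ v) (inj₂ e) (incidencePath k) (incidencePath l)
  incidencePaths-internallyDisjoint {k} {l} k≢l = onlyEndpointsShared , noSharedIncidence
    where
    onlyEndpointsShared : ∀ a → Path._∈ₑ_ (incidencePath k) a → Path._∈ₑ_ (incidencePath l) a →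
      a ≡ inj₁ v ⊎ a ≡ inj₂ e
    onlyEndpointsShared a (zero     , p) _ = inj₁ (sym p)
    onlyEndpointsShared a (suc zero , p) _ = inj₂ (sym p)

    noSharedIncidence : ∀ i → Path._∈ᵢ_ (incidencePath k) i → ¬ Path._∈ᵢ_ (incidencePath l) i
    noSharedIncidence i (zero , p) (zero , q) = k≢l (inc-idx-injective (trans p (sym q)))

  crossTheta-of-incidences : ∀ {a b c} → a ≢ b → a ≢ c → b ≢ c → CrossTheta H
  crossTheta-of-incidences {a} {b} {c} a≢b a≢c b≢c = record
    { v = v ; e = e
    ; P₁ = incidencePath a ; P₂ = incidencePath b ; P₃ = incidencePath c
    ; p₁ = incidencePath-between a ; p₂ = incidencePath-between b ; p₃ = incidencePath-between c
    ; d₁₂ = incidencePaths-internallyDisjoint a≢b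
    ; d₁₃ = incidencePaths-internallyDisjoint a≢c
    ; d₂₃ = incidencePaths-internallyDisjoint b≢c
    }

mainTheorem13 : (H : OrientedHypergraph) (v : Fin (nV H)) (e : Fin (nE H)) →
    3 ≤ ι H v e → CrossTheta H
mainTheorem13 H v e 3≤ι
  with _ , _ , _ , a≢b , a≢c , b≢c ← threeDistinct 3≤ι
  = crossTheta-of-incidences H v e a≢b a≢c b≢c
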